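{- Let $k,n$ be positive integers and $r,t$ integers with $0\le r<n$ and $0\le t\le k$. Then \begin{align*} s_{n,t,r}&=\sum_{j=0}^{t-1}C_{n,j}+\sum_{j=1}^{r}C_{j,t}\,s_{n-j+1,0,1}\\ &=\sum_{j=0}^{t-1}\frac{j+1}{(k+1)n+j+1}\binom{(k+1)n+j+1}{n}+\sum_{j=1}^{r}\frac{t+1}{(k+1)j+t+1}\frac{k}{n-j+1}\binom{(k+1)j+t+1}{j}\binom{(k+1)(n-j)}{n-j}. \end{align*}
   Context: A $k_t$-Dyck path is a lattice path consisting of up-steps $(1,k)$ and down-steps $(1,-1)$ that starts at $(0,0)$, stays weakly above the line $y=-t$, and ends on the line $y=0$; with $n$ up-steps it has length $(k+1)n$. For $n\ge 1$ and $0\le r\le n$, $s_{n,t,r}$ denotes the total number, over all $k_t$-Dyck paths with $n$ up-steps, of down-steps between the $r$-th and $(r+1)$-th up-steps (before the first up-step if $r=0$, after the last if $r=n$). For integers $m,j\ge0$, $C_{m,j}=\frac{j+1}{(k+1)m+j+1}\binom{(k+1)m+j+1}{m}$. -}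

module Defs where

open import Data.Bool using (Bool; true; false; _∧_; if_then_else_)
open import Data.Nat using (ℕ; zero; suc; _+_; _*_; _∸_; _≡ᵇ_)
open import Data.Nat.Combinatorics using (_C_)
open import Data.List using (List; []; _∷_; map; filter; upTo; _++_; length)
open import Data.Integer using (+_)
open import Data.Rational using (ℚ; _/_; 0ℚ) renaming (_+_ to _+ℚ_; _*_ to _*ℚ_)
open import Relation.Nullary.Decidable using (does)
open import Relation.Binary.PropositionalEquality using (_≡_)
import Data.Nat as ℕ

-- A step: true = up-step (1,k), false = down-step (1,-1).
Step : Set
Step = Bool

allSeqs : ℕ → List (List Step)
allSeqs zero    = [] ∷ []
allSeqs (suc m) = map (true ∷_) (allSeqs m) ++ map (false ∷_) (allSeqs m)

ups : List Step → ℕ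
ups []           = 0
ups (true ∷ xs)  = suc (ups xs)
ups (false ∷ xs) = ups xs

-- okFrom k t ℓ xs: starting at shifted level ℓ = y + t (so "weakly above y = -t"
-- means ℓ ≥ 0), the path xs never goes below y = -t and ends on y = 0 (ℓ = t).
okFrom : ℕ → ℕ → ℕ → List Step → Bool
okFrom k t ℓ []             = ℓ ≡ᵇ t
okFrom k t ℓ (true ∷ xs)    = okFrom k t (ℓ + k) xs
okFrom k t zero (false ∷ xs)    = false
okFrom k t (suc ℓ) (false ∷ xs) = okFrom k t ℓ xs

isDyck : ℕ → ℕ → ℕ → List Step → Bool
isDyck k t n xs = okFrom k t t xs ∧ (ups xs ≡ᵇ n)

dyckPaths : ℕ → ℕ → ℕ → List (List Step)
dyckPaths k t n = filter (λ xs → isDyck k t n xs Data.Bool.≟ true) (allSeqs ((k + 1) * n))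

-- Number of down-steps between the r-th and (r+1)-th up-steps
-- (before the first up-step if r = 0, after the last if r = number of ups).
segDowns : ℕ → List Step → ℕ
segDowns zero    []           = 0
segDowns zero    (false ∷ xs) = suc (segDowns zero xs)
segDowns zero    (true ∷ xs)  = 0
segDowns (suc r) []           = 0
segDowns (suc r) (false ∷ xs) = segDowns (suc r) xs
segDowns (suc r) (true ∷ xs)  = segDowns r xs

sumℕ : List ℕ → ℕ
sumℕ []       = 0
sumℕ (x ∷ xs) = x + sumℕ xs

s : (k n t r : ℕ) → ℕ
s k n t r = sumℕ (map (segDowns r) (dyckPaths k t n))

sumℚ : List ℚ → ℚ
sumℚ []       = 0ℚ
sumℚ (x ∷ xs) = x +ℚ sumℚ xs

ℕtoℚ : ℕ → ℚ
ℕtoℚ m = (+ m) / 1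

Cb : (k m j : ℕ) → ℚ
Cb k m j = ((+ (j + 1)) / suc ((k + 1) * m + j)) *ℚ ℕtoℚ (((k + 1) * m + j + 1) C m)

module Submission where

-- Shift heights so that the floor y = -t becomes 0; a k_t-Dyck path is then a
-- path from height t back to height t that never goes below 0.  Let
-- paths k u ℓ count the paths with u up-steps from height ℓ to height 0 that
-- never go below 0, and pathsBelow k u = Σ_{ℓ<k} paths k u ℓ.
--
-- Summing a weight over all 2^L step sequences and splitting
--     off the first step turns s_{n,t,r} into a recursion in (length, height,
--     number of up-steps, r).  Solving it (gapSum) gives, for r < n, t ≤ k,
--        s_{n,t,r} = Σ_{j<t} paths n j + Σ_{j<r} paths (j+1) t · pathsBelow (n-j-1),
--     and in particular s_{u+1,0,1} = pathsBelow u.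
--  2. Ballot numbers.  By induction with Pascal's rule, with P = (k+1)u + ℓ,
--        paths u ℓ · (P+1) = (ℓ+1) · C(P+1, u),    i.e.  paths k u ℓ = C_{u,ℓ},
--     and summing over ℓ < k with the hockey-stick identity,
--        (u+1) · pathsBelow u = k · C((k+1)u, u).
--  3. Rationals.  The embedding ℕ → ℚ is additive and multiplicative, so each
--     of the three expressions of the corollary is the image of one and the
--     same natural number, term by term.

open import Defs
import Data.Bool as Bool
open Bool using (Bool; true; false; _∧_; if_then_else_)
open import Data.Bool.Properties using (∧-zeroʳ)
open import Data.Empty using (⊥-elim)
open import Data.Nat using (ℕ; zero; suc; _+_; _*_; _∸_; _≡ᵇ_; _≤_; _<_; z≤n; s≤s)
open import Data.Nat.Properties
open import Data.Nat.Combinatorics using (_C_; nC1≡n; k>n⇒nCk≡0; nCk+nC[k+1]≡[n+1]C[k+1])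
open import Data.Nat.Tactic.RingSolver using (solve-∀)
open import Data.List using (List; []; _∷_; map; filter; _++_; upTo; applyUpTo)
open import Data.List.Properties using (map-++; map-∘; map-cong; map-applyUpTo)
open import Data.Integer using (+_)
open import Data.Integer using () renaming (_+_ to _+ℤ_; _*_ to _*ℤ_)
import Data.Integer.Properties as ℤ
open import Data.Rational using (ℚ; _/_; toℚᵘ) renaming (_+_ to _+ℚ_; _*_ to _*ℚ_)
open import Data.Rational.Properties
  using (toℚᵘ-injective; toℚᵘ-fromℚᵘ; toℚᵘ-homo-+; toℚᵘ-homo-*)
  renaming (*-assoc to *ℚ-assoc; *-1-commutativeMonoid to *ℚ-1-commutativeMonoid)
open import Data.Rational.Unnormalised as ℚᵘ using (mkℚᵘ; *≡*)
import Data.Rational.Unnormalised.Properties as ℚᵘ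
open import Data.Product using (_×_; _,_)
open import Function using (_∘_; id)
open import Algebra.Bundles using (CommutativeMonoid)
open import Relation.Binary.PropositionalEquality
open ≡-Reasoning

sumℕ-++ : (xs ys : List ℕ) → sumℕ (xs ++ ys) ≡ sumℕ xs + sumℕ ys
sumℕ-++ []       ys = refl
sumℕ-++ (x ∷ xs) ys = trans (cong (_+_ x) (sumℕ-++ xs ys)) (sym (+-assoc x _ _))

sumℕ-map-+ : {A : Set} (g h : A → ℕ) (xs : List A) →
  sumℕ (map (λ x → g x + h x) xs) ≡ sumℕ (map g xs) + sumℕ (map h xs)
sumℕ-map-+ g h []       = refl
sumℕ-map-+ g h (x ∷ xs) = trans (cong (_+_ (g x + h x)) (sumℕ-map-+ g h xs)) (interchange (g x) (h x) _ _)
  where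
  interchange : ∀ a b c d → a + b + (c + d) ≡ a + c + (b + d)
  interchange = solve-∀

sumℕ-map-zero : {A : Set} {h : A → ℕ} → (∀ x → h x ≡ 0) → (xs : List A) → sumℕ (map h xs) ≡ 0
sumℕ-map-zero h≡0 []       = refl
sumℕ-map-zero h≡0 (x ∷ xs) = cong₂ _+_ (h≡0 x) (sumℕ-map-zero h≡0 xs)

sumℕ-filter : {A : Set} (b : A → Bool) (h : A → ℕ) (xs : List A) →
  sumℕ (map h (filter (λ x → b x Bool.≟ true) xs)) ≡ sumℕ (map (λ x → if b x then h x else 0) xs)
sumℕ-filter b h [] = refl
sumℕ-filter b h (x ∷ xs) with b x
... | true  = cong (_+_ (h x)) (sumℕ-filter b h xs)
... | false = sumℕ-filter b h xs

-- sumTo h n = Σ_{i<n} h i, unfolded from the front like applyUpTo.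
sumTo : (ℕ → ℕ) → ℕ → ℕ
sumTo h zero    = 0
sumTo h (suc n) = h 0 + sumTo (h ∘ suc) n

sumTo-last : ∀ h n → sumTo h (suc n) ≡ sumTo h n + h n
sumTo-last h zero    = +-comm (h 0) 0
sumTo-last h (suc n) = trans (cong (_+_ (h 0)) (sumTo-last (h ∘ suc) n)) (sym (+-assoc (h 0) _ _))

sumTo-cong : ∀ {g h} → (∀ i → g i ≡ h i) → ∀ n → sumTo g n ≡ sumTo h n
sumTo-cong g≡h zero    = refl
sumTo-cong g≡h (suc n) = cong₂ _+_ (g≡h 0) (sumTo-cong (g≡h ∘ suc) n)

sumTo-+ : ∀ g h n → sumTo (λ i → g i + h i) n ≡ sumTo g n + sumTo h n
sumTo-+ g h zero    = refl
sumTo-+ g h (suc n) = trans (cong (_+_ (g 0 + h 0)) (sumTo-+ (g ∘ suc) (h ∘ suc) n)) (interchange (g 0) (h 0) _ _)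
  where
  interchange : ∀ a b c d → a + b + (c + d) ≡ a + c + (b + d)
  interchange = solve-∀

sumTo-*ˡ : ∀ c h n → sumTo (λ i → c * h i) n ≡ c * sumTo h n
sumTo-*ˡ c h zero    = sym (*-zeroʳ c)
sumTo-*ˡ c h (suc n) = trans (cong (_+_ (c * h 0)) (sumTo-*ˡ c (h ∘ suc) n)) (sym (*-distribˡ-+ c (h 0) _))

sumSeqs : ℕ → (List Step → ℕ) → ℕ
sumSeqs L h = sumℕ (map h (allSeqs L))

sumSeqs-suc : ∀ L h →
  sumSeqs (suc L) h ≡ sumSeqs L (λ xs → h (true ∷ xs)) + sumSeqs L (λ xs → h (false ∷ xs))
sumSeqs-suc L h = begin
  sumℕ (map h (map (true ∷_) seqs ++ map (false ∷_) seqs))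
    ≡⟨ cong sumℕ (map-++ h (map (true ∷_) seqs) (map (false ∷_) seqs)) ⟩
  sumℕ (map h (map (true ∷_) seqs) ++ map h (map (false ∷_) seqs))
    ≡⟨ sumℕ-++ (map h (map (true ∷_) seqs)) _ ⟩
  sumℕ (map h (map (true ∷_) seqs)) + sumℕ (map h (map (false ∷_) seqs))
    ≡⟨ cong₂ (λ as bs → sumℕ as + sumℕ bs) (map-∘ seqs) (map-∘ seqs) ⟨
  sumSeqs L (λ xs → h (true ∷ xs)) + sumSeqs L (λ xs → h (false ∷ xs)) ∎
  where
  seqs : List (List Step)
  seqs = allSeqs L

≡ᵇ-refl : ∀ m → (m ≡ᵇ m) ≡ true
≡ᵇ-refl zero    = refl
≡ᵇ-refl (suc m) = ≡ᵇ-refl m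

module PathSums (k t : ℕ) where

  weighted : ℕ → ℕ → (List Step → ℕ) → List Step → ℕ
  weighted ℓ u w xs = if okFrom k t ℓ xs ∧ (ups xs ≡ᵇ u) then w xs else 0

  pathSum : ℕ → ℕ → ℕ → (List Step → ℕ) → ℕ
  pathSum L ℓ u w = sumSeqs L (weighted ℓ u w)

  s≡pathSum : ∀ n r → s k n t r ≡ pathSum ((k + 1) * n) t n (segDowns r)
  s≡pathSum n r = sumℕ-filter (λ xs → isDyck k t n xs) (segDowns r) (allSeqs ((k + 1) * n))

  pathSum-+ : ∀ L ℓ u v w → pathSum L ℓ u (λ xs → v xs + w xs) ≡ pathSum L ℓ u v + pathSum L ℓ u w
  pathSum-+ L ℓ u v w = trans (cong sumℕ (map-cong split (allSeqs L)))
                              (sumℕ-map-+ (weighted ℓ u v) (weighted ℓ u w) (allSeqs L))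
    where
    split : ∀ xs → weighted ℓ u (λ ys → v ys + w ys) xs ≡ weighted ℓ u v xs + weighted ℓ u w xs
    split xs with okFrom k t ℓ xs ∧ (ups xs ≡ᵇ u)
    ... | true  = refl
    ... | false = refl

  pathSum-zero : ∀ L ℓ u → pathSum L ℓ u (λ _ → 0) ≡ 0
  pathSum-zero L ℓ u = sumℕ-map-zero vanish (allSeqs L)
    where
    vanish : ∀ xs → weighted ℓ u (λ _ → 0) xs ≡ 0
    vanish xs with okFrom k t ℓ xs ∧ (ups xs ≡ᵇ u)
    ... | true  = refl
    ... | false = refl

  upSum : ℕ → ℕ → ℕ → (List Step → ℕ) → ℕ
  upSum L ℓ zero    w = 0
  upSum L ℓ (suc u) w = pathSum L (ℓ + k) u (λ xs → w (true ∷ xs))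

  downSum : ℕ → ℕ → ℕ → (List Step → ℕ) → ℕ
  downSum L zero    u w = 0
  downSum L (suc ℓ) u w = pathSum L ℓ u (λ xs → w (false ∷ xs))

  pathSum-suc : ∀ L ℓ u w → pathSum (suc L) ℓ u w ≡ upSum L ℓ u w + downSum L ℓ u w
  pathSum-suc L ℓ u w = trans (sumSeqs-suc L (weighted ℓ u w)) (cong₂ _+_ (firstUp u) (firstDown ℓ))
    where
    firstUp : ∀ u → sumSeqs L (λ xs → weighted ℓ u w (true ∷ xs)) ≡ upSum L ℓ u w
    firstUp zero    = sumℕ-map-zero
      (λ xs → cong (λ b → if b then w (true ∷ xs) else 0) (∧-zeroʳ (okFrom k t (ℓ + k) xs)))
      (allSeqs L)
    firstUp (suc u) = refl
    firstDown : ∀ ℓ → sumSeqs L (λ xs → weighted ℓ u w (false ∷ xs)) ≡ downSum L ℓ u w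
    firstDown zero    = sumℕ-map-zero (λ _ → refl) (allSeqs L)
    firstDown (suc ℓ) = refl

-- paths k u ℓ: the number of paths with u up-steps (1,k) and down-steps
-- (1,-1) from height ℓ to height 0 that never go below 0 (first-step recursion).
paths : ℕ → ℕ → ℕ → ℕ
paths k zero    ℓ       = 1
paths k (suc u) zero    = paths k u k
paths k (suc u) (suc ℓ) = paths k u (suc ℓ + k) + paths k (suc u) ℓ

-- pathsBelow k u = Σ_{ℓ<k} paths k u ℓ; it will turn out to be s_{u+1,0,1}.
pathsBelow : ℕ → ℕ → ℕ
pathsBelow k u = sumTo (paths k u) k

paths-suc-prefix : ∀ k u ℓ → paths k (suc u) ℓ + pathsBelow k u ≡ sumTo (paths k u) (suc ℓ + k)
paths-suc-prefix k u zero    = trans (+-comm (paths k u k) _) (sym (sumTo-last (paths k u) k))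
paths-suc-prefix k u (suc ℓ) = begin
  paths k u (suc ℓ + k) + paths k (suc u) ℓ + pathsBelow k u
    ≡⟨ rotate (paths k u (suc ℓ + k)) (paths k (suc u) ℓ) (pathsBelow k u) ⟩
  paths k (suc u) ℓ + pathsBelow k u + paths k u (suc ℓ + k)
    ≡⟨ cong (_+ paths k u (suc ℓ + k)) (paths-suc-prefix k u ℓ) ⟩
  sumTo (paths k u) (suc ℓ + k) + paths k u (suc ℓ + k)
    ≡⟨ sumTo-last (paths k u) (suc ℓ + k) ⟨
  sumTo (paths k u) (suc (suc ℓ) + k) ∎
  where
  rotate : ∀ a b c → a + b + c ≡ b + c + a
  rotate = solve-∀

gapTotal : (k ℓ u r : ℕ) → ℕ
gapTotal k ℓ u r = sumTo (paths k u) ℓ + sumTo (λ j → paths k (suc j) ℓ * pathsBelow k (u ∸ suc j)) r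

-- The three recurrences of gapTotal matching the first-step decomposition.
gapTotal-r0 : ∀ k ℓ u → gapTotal k (suc ℓ) (suc u) 0 ≡ paths k (suc u) ℓ + gapTotal k ℓ (suc u) 0
gapTotal-r0 k ℓ u = begin
  sumTo (paths k (suc u)) (suc ℓ) + 0
    ≡⟨ cong (_+ 0) (sumTo-last (paths k (suc u)) ℓ) ⟩
  sumTo (paths k (suc u)) ℓ + paths k (suc u) ℓ + 0
    ≡⟨ swap (sumTo (paths k (suc u)) ℓ) (paths k (suc u) ℓ) ⟩
  paths k (suc u) ℓ + (sumTo (paths k (suc u)) ℓ + 0) ∎
  where
  swap : ∀ a b → a + b + 0 ≡ b + (a + 0)
  swap = solve-∀

gapTotal-floor : ∀ k u r → gapTotal k 0 (suc u) (suc r) ≡ gapTotal k k u r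
gapTotal-floor k u r = cong (_+ sumTo (λ j → paths k (suc j) k * pathsBelow k (u ∸ suc j)) r)
                            (*-identityˡ (pathsBelow k u))

gapTotal-step : ∀ k ℓ u r →
  gapTotal k (suc ℓ) (suc u) (suc r) ≡ gapTotal k (suc ℓ + k) u r + gapTotal k ℓ (suc u) (suc r)
gapTotal-step k ℓ u r = begin
  sumTo (paths k (suc u)) (suc ℓ) + sumTo (λ j → paths k (suc j) (suc ℓ) * below j) (suc r)
    ≡⟨ cong₂ _+_ (sumTo-last (paths k (suc u)) ℓ) splitFirst ⟩
  A + paths k (suc u) ℓ + ((1 * pathsBelow k u + D) + E)
    ≡⟨ regroup A (paths k (suc u) ℓ) (pathsBelow k u) D E ⟩
  A + (paths k (suc u) ℓ + pathsBelow k u) + D + E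
    ≡⟨ cong (λ z → A + z + D + E) (paths-suc-prefix k u ℓ) ⟩
  A + sumTo (paths k u) (suc ℓ + k) + D + E
    ≡⟨ regroup′ A (sumTo (paths k u) (suc ℓ + k)) D E ⟩
  (sumTo (paths k u) (suc ℓ + k) + D) + (A + E) ∎
  where
  below : ℕ → ℕ
  below j = pathsBelow k (suc u ∸ suc j)
  A D E : ℕ
  A = sumTo (paths k (suc u)) ℓ
  D = sumTo (λ j → paths k (suc j) (suc ℓ + k) * pathsBelow k (u ∸ suc j)) r
  E = sumTo (λ j → paths k (suc j) ℓ * below j) (suc r)
  -- paths k (j+1) (ℓ+1) = paths k j (ℓ+1+k) + paths k (j+1) ℓ splits the second sum.
  splitFirst : sumTo (λ j → paths k (suc j) (suc ℓ) * below j) (suc r) ≡ (1 * pathsBelow k u + D) + E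
  splitFirst = trans (sumTo-cong (λ j → *-distribʳ-+ (below j) (paths k j (suc ℓ + k)) (paths k (suc j) ℓ)) (suc r))
                     (sumTo-+ (λ j → paths k j (suc ℓ + k) * below j) (λ j → paths k (suc j) ℓ * below j) (suc r))
  regroup : ∀ c a b d e → c + a + ((1 * b + d) + e) ≡ c + (a + b) + d + e
  regroup = solve-∀
  regroup′ : ∀ c b d e → c + b + d + e ≡ (b + d) + (c + e)
  regroup′ = solve-∀

module SolvedPathSums (k t : ℕ) (t≤k : t ≤ k) where
  open PathSums k t

  -- The length bookkeeping L + t = ℓ + u(k+1) fails for L = 0 and u ≥ 1,
  -- because t ≤ k < k+1.
  noEmptyUp : ∀ ℓ v → t ≢ ℓ + suc v * suc k
  noEmptyUp ℓ v t≡ = n≮n k (≤-trans (subst (suc k ≤_) (sym t≡) (≤-trans (m≤m+n (suc k) _) (m≤n+m _ ℓ))) t≤k)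

  afterUp : ∀ L ℓ v → suc L + t ≡ ℓ + suc v * suc k → L + t ≡ ℓ + k + v * suc k
  afterUp L ℓ v eq = suc-injective (trans eq (shift ℓ v k))
    where
    shift : ∀ ℓ v k → ℓ + suc v * suc k ≡ suc (ℓ + k + v * suc k)
    shift = solve-∀

  pathCount : ∀ L ℓ u → L + t ≡ ℓ + u * suc k → pathSum L ℓ u (λ _ → 1) ≡ paths k u ℓ
  pathCount zero    ℓ       zero    eq rewrite trans eq (+-identityʳ ℓ) | ≡ᵇ-refl ℓ = refl
  pathCount zero    ℓ       (suc v) eq = ⊥-elim (noEmptyUp ℓ v eq)
  pathCount (suc L) (suc ℓ) zero    eq = trans (pathSum-suc L (suc ℓ) 0 _) (pathCount L ℓ 0 (suc-injective eq))
  pathCount (suc L) zero    (suc v) eq =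
    trans (pathSum-suc L 0 (suc v) _) (trans (+-identityʳ _) (pathCount L k v (afterUp L 0 v eq)))
  pathCount (suc L) (suc ℓ) (suc v) eq = trans (pathSum-suc L (suc ℓ) (suc v) _)
    (cong₂ _+_ (pathCount L (suc ℓ + k) v (afterUp L (suc ℓ) v eq)) (pathCount L ℓ (suc v) (suc-injective eq)))

  gapSum : ∀ L ℓ u r → r < u → L + t ≡ ℓ + u * suc k → pathSum L ℓ u (segDowns r) ≡ gapTotal k ℓ u r
  gapSum zero    ℓ (suc v) r _ eq = ⊥-elim (noEmptyUp ℓ v eq)
  gapSum (suc L) zero (suc u) zero _ eq =
    trans (pathSum-suc L 0 (suc u) (segDowns 0)) (trans (+-identityʳ _) (pathSum-zero L k u))
  gapSum (suc L) (suc ℓ) (suc u) zero r<u eq = begin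
    pathSum (suc L) (suc ℓ) (suc u) (segDowns 0)
      ≡⟨ pathSum-suc L (suc ℓ) (suc u) (segDowns 0) ⟩
    pathSum L (suc ℓ + k) u (λ _ → 0) + pathSum L ℓ (suc u) (λ xs → 1 + segDowns 0 xs)
      ≡⟨ cong₂ _+_ (pathSum-zero L (suc ℓ + k) u) (pathSum-+ L ℓ (suc u) (λ _ → 1) (segDowns 0)) ⟩
    pathSum L ℓ (suc u) (λ _ → 1) + pathSum L ℓ (suc u) (segDowns 0)
      ≡⟨ cong₂ _+_ (pathCount L ℓ (suc u) eq′) (gapSum L ℓ (suc u) 0 r<u eq′) ⟩
    paths k (suc u) ℓ + gapTotal k ℓ (suc u) 0
      ≡⟨ gapTotal-r0 k ℓ u ⟨
    gapTotal k (suc ℓ) (suc u) 0 ∎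
    where
    eq′ : L + t ≡ ℓ + suc u * suc k
    eq′ = suc-injective eq
  gapSum (suc L) zero (suc u) (suc r) (s≤s r<u) eq = begin
    pathSum (suc L) 0 (suc u) (segDowns (suc r))
      ≡⟨ pathSum-suc L 0 (suc u) (segDowns (suc r)) ⟩
    pathSum L k u (segDowns r) + 0
      ≡⟨ +-identityʳ _ ⟩
    pathSum L k u (segDowns r)
      ≡⟨ gapSum L k u r r<u (afterUp L 0 u eq) ⟩
    gapTotal k k u r
      ≡⟨ gapTotal-floor k u r ⟨
    gapTotal k 0 (suc u) (suc r) ∎
  gapSum (suc L) (suc ℓ) (suc u) (suc r) (s≤s r<u) eq = begin
    pathSum (suc L) (suc ℓ) (suc u) (segDowns (suc r))
      ≡⟨ pathSum-suc L (suc ℓ) (suc u) (segDowns (suc r)) ⟩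
    pathSum L (suc ℓ + k) u (segDowns r) + pathSum L ℓ (suc u) (segDowns (suc r))
      ≡⟨ cong₂ _+_ (gapSum L (suc ℓ + k) u r r<u (afterUp L (suc ℓ) u eq))
                   (gapSum L ℓ (suc u) (suc r) (s≤s r<u) (suc-injective eq)) ⟩
    gapTotal k (suc ℓ + k) u r + gapTotal k ℓ (suc u) (suc r)
      ≡⟨ gapTotal-step k ℓ u r ⟨
    gapTotal k (suc ℓ) (suc u) (suc r) ∎

s-gapTotal : ∀ k n t r → t ≤ k → r < n → s k n t r ≡ gapTotal k t n r
s-gapTotal k n t r t≤k r<n =
  trans (PathSums.s≡pathSum k t n r) (SolvedPathSums.gapSum k t t≤k ((k + 1) * n) t n r r<n (length k n t))
  where
  length : ∀ k n t → (k + 1) * n + t ≡ t + n * suc k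
  length = solve-∀

s01 : ∀ k u → 1 ≤ u → s k (u + 1) 0 1 ≡ pathsBelow k u
s01 k u 1≤u = begin
  s k (u + 1) 0 1
    ≡⟨ s-gapTotal k (u + 1) 0 1 z≤n (+-monoˡ-≤ 1 1≤u) ⟩
  1 * pathsBelow k (u + 1 ∸ 1) + 0
    ≡⟨ trans (+-identityʳ _) (*-identityˡ _) ⟩
  pathsBelow k (u + 1 ∸ 1)
    ≡⟨ cong (pathsBelow k) (m+n∸n≡m u 1) ⟩
  pathsBelow k u ∎

pascal : ∀ n m → suc n C suc m ≡ n C m + n C suc m
pascal n m = sym (nCk+nC[k+1]≡[n+1]C[k+1] n m)

absorption : ∀ n m → suc m * (suc n C suc m) ≡ suc n * (n C m)
absorption n       zero    = trans (+-identityʳ _) (trans (nC1≡n (suc n)) (sym (*-identityʳ (suc n))))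
absorption zero    (suc m) = begin
  suc (suc m) * (1 C suc (suc m))   ≡⟨ cong (suc (suc m) *_) (k>n⇒nCk≡0 {1} {suc (suc m)} (s≤s (s≤s z≤n))) ⟩
  suc (suc m) * 0                   ≡⟨ *-zeroʳ (suc (suc m)) ⟩
  0                                 ≡⟨ cong (1 *_) (k>n⇒nCk≡0 {0} {suc m} (s≤s z≤n)) ⟨
  1 * (0 C suc m)                   ∎
absorption (suc n) (suc m) = begin
  suc (suc m) * (suc (suc n) C suc (suc m))
    ≡⟨ cong (suc (suc m) *_) (pascal (suc n) (suc m)) ⟩
  suc (suc m) * (suc n C suc m + suc n C suc (suc m))
    ≡⟨ expand m (suc n C suc m) (suc n C suc (suc m)) ⟩
  suc n C suc m + suc m * (suc n C suc m) + suc (suc m) * (suc n C suc (suc m))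
    ≡⟨ cong₂ (λ a b → suc n C suc m + a + b) (absorption n m) (absorption n (suc m)) ⟩
  suc n C suc m + suc n * (n C m) + suc n * (n C suc m)
    ≡⟨ +-assoc (suc n C suc m) _ _ ⟩
  suc n C suc m + (suc n * (n C m) + suc n * (n C suc m))
    ≡⟨ cong (_+_ (suc n C suc m)) (*-distribˡ-+ (suc n) (n C m) (n C suc m)) ⟨
  suc n C suc m + suc n * (n C m + n C suc m)
    ≡⟨ cong (λ z → suc n C suc m + suc n * z) (pascal n m) ⟨
  suc (suc n) * (suc n C suc m) ∎
  where
  expand : ∀ m a b → suc (suc m) * (a + b) ≡ a + suc m * a + suc (suc m) * b
  expand = solve-∀

hockeyStick : ∀ M w b → sumTo (λ a → (M + a) C w) b + M C suc w ≡ (M + b) C suc w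
hockeyStick M w zero    = cong (_C suc w) (sym (+-identityʳ M))
hockeyStick M w (suc b) = begin
  sumTo (λ a → (M + a) C w) (suc b) + M C suc w
    ≡⟨ cong (_+ M C suc w) (sumTo-last (λ a → (M + a) C w) b) ⟩
  sumTo (λ a → (M + a) C w) b + (M + b) C w + M C suc w
    ≡⟨ move (sumTo (λ a → (M + a) C w) b) ((M + b) C w) (M C suc w) ⟩
  (M + b) C w + (sumTo (λ a → (M + a) C w) b + M C suc w)
    ≡⟨ cong (_+_ ((M + b) C w)) (hockeyStick M w b) ⟩
  (M + b) C w + (M + b) C suc w
    ≡⟨ pascal (M + b) w ⟨
  suc (M + b) C suc w
    ≡⟨ cong (_C suc w) (+-suc M b) ⟨
  (M + suc b) C suc w ∎
  where
  move : ∀ a b c → a + b + c ≡ b + (a + c)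
  move = solve-∀

-- Ballot numbers.  steps k u ℓ = (k+1)u + ℓ is the length of every path
-- counted by paths k u ℓ.
steps : ℕ → ℕ → ℕ → ℕ
steps k u ℓ = suc k * u + ℓ

steps-floor : ∀ k u → suc (steps k u k) ≡ steps k (suc u) 0
steps-floor k u = regroup k u
  where
  regroup : ∀ k u → suc (suc k * u + k) ≡ suc k * suc u + 0
  regroup = solve-∀

absorb-multiple : ∀ k u → suc (steps k u k) C suc u ≡ suc k * (steps k u k C u)
absorb-multiple k u = *-cancelˡ-≡ _ _ (suc u) (trans (absorption (steps k u k) u) (regroup k u _))
  where
  regroup : ∀ k u c → suc (suc k * u + k) * c ≡ suc u * (suc k * c)
  regroup = solve-∀

-- The subtracted term C(steps k u ℓ, u-1) of the ballot formula (0 if u = 0).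
ballotCorrection : ℕ → ℕ → ℕ → ℕ
ballotCorrection k zero    ℓ = 0
ballotCorrection k (suc u) ℓ = steps k (suc u) ℓ C u

correction-shift : ∀ k u ℓ →
  ballotCorrection k u (suc ℓ + k) + steps k (suc u) ℓ C u ≡ suc (steps k (suc u) ℓ) C u
correction-shift k zero    ℓ = refl
correction-shift k (suc v) ℓ =
  trans (cong (λ z → z C v + R C suc v) (regroup k v ℓ)) (sym (pascal R v))
  where
  R : ℕ
  R = steps k (suc (suc v)) ℓ
  regroup : ∀ k v ℓ → suc k * suc v + (suc ℓ + k) ≡ suc k * suc (suc v) + ℓ
  regroup = solve-∀

correction-floor : ∀ k u →
  suc k * (suc (steps k u k) C u) ≡ suc (steps k u k) C suc u + suc k * ballotCorrection k u k
correction-floor k zero    = trans (regroup k) (cong (_+ suc k * 0) (sym (nC1≡n (suc (steps k 0 k)))))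
  where
  regroup : ∀ k → suc k * 1 ≡ suc (suc k * 0 + k) + suc k * 0
  regroup = solve-∀
correction-floor k (suc v) = begin
  suc k * (suc Q C suc v)
    ≡⟨ cong (suc k *_) (pascal Q v) ⟩
  suc k * (Q C v + Q C suc v)
    ≡⟨ *-distribˡ-+ (suc k) (Q C v) (Q C suc v) ⟩
  suc k * (Q C v) + suc k * (Q C suc v)
    ≡⟨ +-comm (suc k * (Q C v)) _ ⟩
  suc k * (Q C suc v) + suc k * (Q C v)
    ≡⟨ cong (_+ suc k * (Q C v)) (absorb-multiple k (suc v)) ⟨
  suc Q C suc (suc v) + suc k * (Q C v) ∎
  where
  Q : ℕ
  Q = steps k (suc v) k

ballot-difference : ∀ k u ℓ → paths k u ℓ + suc k * ballotCorrection k u ℓ ≡ suc (steps k u ℓ) C u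
ballot-difference k zero    ℓ = cong suc (*-zeroʳ k)
ballot-difference k (suc u) zero = begin
  paths k u k + suc k * (steps k (suc u) 0 C u)
    ≡⟨ cong (λ z → paths k u k + suc k * (z C u)) (steps-floor k u) ⟨
  paths k u k + suc k * (suc Q C u)
    ≡⟨ cong (_+_ (paths k u k)) (correction-floor k u) ⟩
  paths k u k + (suc Q C suc u + suc k * ballotCorrection k u k)
    ≡⟨ move (paths k u k) _ _ ⟩
  (paths k u k + suc k * ballotCorrection k u k) + suc Q C suc u
    ≡⟨ cong (_+ suc Q C suc u) (ballot-difference k u k) ⟩
  suc Q C u + suc Q C suc u
    ≡⟨ pascal (suc Q) u ⟨
  suc (suc Q) C suc u
    ≡⟨ cong (λ z → suc z C suc u) (steps-floor k u) ⟩
  suc (steps k (suc u) 0) C suc u ∎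
  where
  Q : ℕ
  Q = steps k u k
  move : ∀ a b c → a + (b + c) ≡ (a + c) + b
  move = solve-∀
ballot-difference k (suc u) (suc ℓ) = begin
  paths k u (suc ℓ + k) + paths k (suc u) ℓ + suc k * (steps k (suc u) (suc ℓ) C u)
    ≡⟨ cong (λ z → paths k u (suc ℓ + k) + paths k (suc u) ℓ + suc k * (z C u)) stepsR ⟨
  paths k u (suc ℓ + k) + paths k (suc u) ℓ + suc k * (suc R C u)
    ≡⟨ cong (λ z → paths k u (suc ℓ + k) + paths k (suc u) ℓ + suc k * z) (correction-shift k u ℓ) ⟨
  paths k u (suc ℓ + k) + paths k (suc u) ℓ + suc k * (ballotCorrection k u (suc ℓ + k) + R C u)
    ≡⟨ regroup (paths k u (suc ℓ + k)) (paths k (suc u) ℓ) (suc k) _ (R C u) ⟩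
  (paths k u (suc ℓ + k) + suc k * ballotCorrection k u (suc ℓ + k)) + (paths k (suc u) ℓ + suc k * (R C u))
    ≡⟨ cong₂ _+_ (ballot-difference k u (suc ℓ + k)) (ballot-difference k (suc u) ℓ) ⟩
  suc (steps k u (suc ℓ + k)) C u + suc R C suc u
    ≡⟨ cong (λ z → suc z C u + suc R C suc u) (sameLength k u ℓ) ⟩
  suc R C u + suc R C suc u
    ≡⟨ pascal (suc R) u ⟨
  suc (suc R) C suc u
    ≡⟨ cong (λ z → suc z C suc u) stepsR ⟩
  suc (steps k (suc u) (suc ℓ)) C suc u ∎
  where
  R : ℕ
  R = steps k (suc u) ℓ
  stepsR : suc R ≡ steps k (suc u) (suc ℓ)
  stepsR = sym (+-suc (suc k * suc u) ℓ)
  sameLength : ∀ k u ℓ → suc k * u + (suc ℓ + k) ≡ suc k * suc u + ℓ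
  sameLength = solve-∀
  regroup : ∀ a b c d e → a + b + c * (d + e) ≡ (a + c * d) + (b + c * e)
  regroup = solve-∀

ballot : ∀ k u ℓ → paths k u ℓ * suc (steps k u ℓ) ≡ suc ℓ * (suc (steps k u ℓ) C u)
ballot k zero    ℓ = regroup k ℓ
  where
  regroup : ∀ k ℓ → 1 * suc (suc k * 0 + ℓ) ≡ suc ℓ * 1
  regroup = solve-∀
ballot k (suc v) ℓ = +-cancelˡ-≡ (suc k * (suc v * X)) _ _ (begin
  suc k * (suc v * X) + paths k (suc v) ℓ * N
    ≡⟨ cong (λ z → suc k * z + paths k (suc v) ℓ * N) (absorption (steps k (suc v) ℓ) v) ⟩
  suc k * (N * ballotCorrection k (suc v) ℓ) + paths k (suc v) ℓ * N
    ≡⟨ factor (suc k) N (ballotCorrection k (suc v) ℓ) (paths k (suc v) ℓ) ⟩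
  N * (paths k (suc v) ℓ + suc k * ballotCorrection k (suc v) ℓ)
    ≡⟨ cong (N *_) (ballot-difference k (suc v) ℓ) ⟩
  N * X
    ≡⟨ split k v ℓ X ⟩
  suc k * (suc v * X) + suc ℓ * X ∎)
  where
  N X : ℕ
  N = suc (steps k (suc v) ℓ)
  X = N C suc v
  factor : ∀ a n b p → a * (n * b) + p * n ≡ n * (p + a * b)
  factor = solve-∀
  split : ∀ k v ℓ x → suc (suc k * suc v + ℓ) * x ≡ suc k * (suc v * x) + suc ℓ * x
  split = solve-∀

-- Summing the difference form over ℓ < k and applying the hockey stick twice:
--   pathsBelow k u + C(M+1, u+1) = (k+1) · C(M, u),   M = (k+1)u,  u ≥ 1.
pathsBelow-binomial : ∀ k v →
  pathsBelow k (suc v) + suc (suc k * suc v) C suc (suc v) ≡ suc k * ((suc k * suc v) C suc v)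
pathsBelow-binomial k v = +-cancelˡ-≡ (suc k * lower) _ _ (begin
  suc k * lower + (pathsBelow k U + T)
    ≡⟨ move (pathsBelow k U) (suc k * lower) T ⟩
  (pathsBelow k U + suc k * lower) + T
    ≡⟨ cong (_+ T) summedDifference ⟩
  upper + T
    ≡⟨ hockeyStick (suc M) U k ⟩
  (suc M + k) C suc U
    ≡⟨ absorb-multiple k U ⟩
  suc k * ((M + k) C U)
    ≡⟨ cong (suc k *_) (hockeyStick M v k) ⟨
  suc k * (lower + M C U)
    ≡⟨ *-distribˡ-+ (suc k) lower (M C U) ⟩
  suc k * lower + suc k * (M C U) ∎)
  where
  U M T lower upper : ℕ
  U = suc v
  M = suc k * U
  T = suc M C suc U
  lower = sumTo (λ a → (M + a) C v) k
  upper = sumTo (λ a → suc (M + a) C U) k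
  summedDifference : pathsBelow k U + suc k * lower ≡ upper
  summedDifference = begin
    pathsBelow k U + suc k * lower
      ≡⟨ cong (_+_ (pathsBelow k U)) (sumTo-*ˡ (suc k) (λ a → (M + a) C v) k) ⟨
    pathsBelow k U + sumTo (λ a → suc k * ((M + a) C v)) k
      ≡⟨ sumTo-+ (paths k U) (λ a → suc k * ((M + a) C v)) k ⟨
    sumTo (λ a → paths k U a + suc k * ((M + a) C v)) k
      ≡⟨ sumTo-cong (ballot-difference k U) k ⟩
    upper ∎
  move : ∀ s a t → a + (s + t) ≡ (s + a) + t
  move = solve-∀

pathsBelow-closed : ∀ k u → suc u * pathsBelow k u ≡ k * ((suc k * u) C u)
pathsBelow-closed k zero    = trans (*-identityˡ _) (trans (sumOnes k) (sym (*-identityʳ k)))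
  where
  sumOnes : ∀ n → sumTo (λ _ → 1) n ≡ n
  sumOnes zero    = refl
  sumOnes (suc n) = cong suc (sumOnes n)
pathsBelow-closed k (suc v) = +-cancelʳ-≡ (suc M * (M C U)) _ _ (begin
  suc U * pathsBelow k U + suc M * (M C U)
    ≡⟨ cong (_+_ (suc U * pathsBelow k U)) (absorption M U) ⟨
  suc U * pathsBelow k U + suc U * (suc M C suc U)
    ≡⟨ *-distribˡ-+ (suc U) (pathsBelow k U) _ ⟨
  suc U * (pathsBelow k U + suc M C suc U)
    ≡⟨ cong (suc U *_) (pathsBelow-binomial k v) ⟩
  suc U * (suc k * (M C U))
    ≡⟨ split k v (M C U) ⟩
  k * (M C U) + suc M * (M C U) ∎)
  where
  U M : ℕ
  U = suc v
  M = suc k * U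
  split : ∀ k v c → suc (suc v) * (suc k * c) ≡ k * c + suc (suc k * suc v) * c
  split = solve-∀

toℚᵘ-/ : ∀ i d → toℚᵘ (i / suc d) ℚᵘ.≃ mkℚᵘ i d
toℚᵘ-/ i d = toℚᵘ-fromℚᵘ (mkℚᵘ i d)

ℕtoℚ-+ : ∀ a b → ℕtoℚ (a + b) ≡ ℕtoℚ a +ℚ ℕtoℚ b
ℕtoℚ-+ a b = toℚᵘ-injective (begin≃
  toℚᵘ (ℕtoℚ (a + b))                   ≈⟨ toℚᵘ-/ (+ (a + b)) 0 ⟩
  mkℚᵘ (+ (a + b)) 0                    ≈⟨ *≡* crossMultiplied ⟩
  mkℚᵘ (+ a) 0 ℚᵘ.+ mkℚᵘ (+ b) 0        ≈⟨ ℚᵘ.+-cong (toℚᵘ-/ (+ a) 0) (toℚᵘ-/ (+ b) 0) ⟨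
  toℚᵘ (ℕtoℚ a) ℚᵘ.+ toℚᵘ (ℕtoℚ b)      ≈⟨ toℚᵘ-homo-+ (ℕtoℚ a) (ℕtoℚ b) ⟨
  toℚᵘ (ℕtoℚ a +ℚ ℕtoℚ b)               ≃∎)
  where
  open ℚᵘ.≃-Reasoning using (step-≈-⟩; step-≈-⟨) renaming (begin_ to begin≃_; _∎ to _≃∎)
  sum : ℚᵘ.ℚᵘ
  sum = mkℚᵘ (+ a) 0 ℚᵘ.+ mkℚᵘ (+ b) 0
  crossMultiplied : + (a + b) *ℤ ℚᵘ.↧ sum ≡ ℚᵘ.↥ sum *ℤ + 1
  crossMultiplied = trans (ℤ.*-identityʳ _) (trans (ℤ.pos-+ a b)
    (sym (trans (ℤ.*-identityʳ _) (cong₂ _+ℤ_ (ℤ.*-identityʳ (+ a)) (ℤ.*-identityʳ (+ b))))))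

ℕtoℚ-fraction : ∀ x p q b → x * suc q ≡ p * b → ℕtoℚ x ≡ ((+ p) / suc q) *ℚ ℕtoℚ b
ℕtoℚ-fraction x p q b eq = toℚᵘ-injective (begin≃
  toℚᵘ (ℕtoℚ x)                             ≈⟨ toℚᵘ-/ (+ x) 0 ⟩
  mkℚᵘ (+ x) 0                              ≈⟨ *≡* crossMultiplied ⟩
  mkℚᵘ (+ p) q ℚᵘ.* mkℚᵘ (+ b) 0            ≈⟨ ℚᵘ.*-cong (toℚᵘ-/ (+ p) q) (toℚᵘ-/ (+ b) 0) ⟨
  toℚᵘ ((+ p) / suc q) ℚᵘ.* toℚᵘ (ℕtoℚ b)   ≈⟨ toℚᵘ-homo-* ((+ p) / suc q) (ℕtoℚ b) ⟨
  toℚᵘ (((+ p) / suc q) *ℚ ℕtoℚ b)          ≃∎)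
  where
  open ℚᵘ.≃-Reasoning using (step-≈-⟩; step-≈-⟨) renaming (begin_ to begin≃_; _∎ to _≃∎)
  natural : x * suc (q * 1) ≡ p * b * 1
  natural = trans (cong (λ z → x * suc z) (*-identityʳ q)) (trans eq (sym (*-identityʳ (p * b))))
  product : ℚᵘ.ℚᵘ
  product = mkℚᵘ (+ p) q ℚᵘ.* mkℚᵘ (+ b) 0
  crossMultiplied : + x *ℤ ℚᵘ.↧ product ≡ ℚᵘ.↥ product *ℤ + 1
  crossMultiplied = trans (sym (ℤ.pos-* x _)) (trans (cong +_ natural)
    (trans (ℤ.pos-* (p * b) 1) (cong (_*ℤ + 1) (ℤ.pos-* p b))))

ℕtoℚ-* : ∀ a b → ℕtoℚ (a * b) ≡ ℕtoℚ a *ℚ ℕtoℚ b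
ℕtoℚ-* a b = ℕtoℚ-fraction (a * b) a 0 b (*-identityʳ (a * b))

sumℚ-applyUpTo : ∀ (q : ℕ → ℚ) (h : ℕ → ℕ) n →
  (∀ j → j < n → q j ≡ ℕtoℚ (h j)) → sumℚ (applyUpTo q n) ≡ ℕtoℚ (sumTo h n)
sumℚ-applyUpTo q h zero    _   = refl
sumℚ-applyUpTo q h (suc n) q≡h = trans
  (cong₂ _+ℚ_ (q≡h 0 (s≤s z≤n)) (sumℚ-applyUpTo (q ∘ suc) (h ∘ suc) n (λ j j<n → q≡h (suc j) (s≤s j<n))))
  (sym (ℕtoℚ-+ (h 0) _))

sumℚ-upTo : ∀ (q : ℕ → ℚ) (h : ℕ → ℕ) n →
  (∀ j → j < n → q j ≡ ℕtoℚ (h j)) → sumℚ (map q (upTo n)) ≡ ℕtoℚ (sumTo h n)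
sumℚ-upTo q h n q≡h = trans (cong sumℚ (map-applyUpTo id q n)) (sumℚ-applyUpTo q h n q≡h)

Cb≡paths : ∀ k m j → Cb k m j ≡ ℕtoℚ (paths k m j)
Cb≡paths k m j = sym (ℕtoℚ-fraction (paths k m j) (j + 1) ((k + 1) * m + j) _ ballot′)
  where
  -- ballot k m j, written with k + 1 and j + 1 in place of suc k and suc j.
  ballot′ : paths k m j * suc ((k + 1) * m + j) ≡ (j + 1) * (((k + 1) * m + j + 1) C m)
  ballot′ rewrite +-comm k 1 | +-comm j 1 | +-comm (suc k * m + j) 1 = ballot k m j

pathsBelow≡fraction : ∀ k u → ℕtoℚ (pathsBelow k u) ≡ ((+ k) / suc u) *ℚ ℕtoℚ (((k + 1) * u) C u)
pathsBelow≡fraction k u = ℕtoℚ-fraction (pathsBelow k u) k u _ closed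
  where
  closed : pathsBelow k u * suc u ≡ k * (((k + 1) * u) C u)
  closed rewrite +-comm k 1 = trans (*-comm (pathsBelow k u) (suc u)) (pathsBelow-closed k u)

gapTerm : (k n t j : ℕ) → ℕ
gapTerm k n t j = paths k (suc j) t * pathsBelow k (n ∸ suc j)

-- Second sum of the first expression, where s_{n-j,0,1} = pathsBelow (n-j-1).
recursiveGapSum : ∀ k n r t → r < n →
  sumℚ (map (λ i → Cb k (suc i) t *ℚ ℕtoℚ (s k (n ∸ suc i + 1) 0 1)) (upTo r))
  ≡ ℕtoℚ (sumTo (gapTerm k n t) r)
recursiveGapSum k n r t r<n = sumℚ-upTo _ (gapTerm k n t) r term
  where
  term : ∀ i → i < r → Cb k (suc i) t *ℚ ℕtoℚ (s k (n ∸ suc i + 1) 0 1) ≡ ℕtoℚ (gapTerm k n t i)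
  term i i<r = begin
    Cb k (suc i) t *ℚ ℕtoℚ (s k (n ∸ suc i + 1) 0 1)
      ≡⟨ cong₂ _*ℚ_ (Cb≡paths k (suc i) t) (cong ℕtoℚ (s01 k (n ∸ suc i) (m<n⇒0<n∸m (<-≤-trans (s≤s i<r) r<n)))) ⟩
    ℕtoℚ (paths k (suc i) t) *ℚ ℕtoℚ (pathsBelow k (n ∸ suc i))
      ≡⟨ ℕtoℚ-* (paths k (suc i) t) _ ⟨
    ℕtoℚ (gapTerm k n t i) ∎

closedGapSum : ∀ k n r t →
  sumℚ (map (λ i → ((+ (t + 1)) / suc ((k + 1) * suc i + t))
                     *ℚ ((+ k) / suc (n ∸ suc i))
                     *ℚ ℕtoℚ (((k + 1) * suc i + t + 1) C (suc i))
                     *ℚ ℕtoℚ (((k + 1) * (n ∸ suc i)) C (n ∸ suc i))) (upTo r))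
  ≡ ℕtoℚ (sumTo (gapTerm k n t) r)
closedGapSum k n r t = sumℚ-upTo _ (gapTerm k n t) r (λ i _ → term i)
  where
  open import Algebra.Properties.CommutativeSemigroup
    (CommutativeMonoid.commutativeSemigroup *ℚ-1-commutativeMonoid) using () renaming (interchange to *-interchange)
  term : ∀ i → ((+ (t + 1)) / suc ((k + 1) * suc i + t)) *ℚ ((+ k) / suc (n ∸ suc i))
                 *ℚ ℕtoℚ (((k + 1) * suc i + t + 1) C (suc i)) *ℚ ℕtoℚ (((k + 1) * (n ∸ suc i)) C (n ∸ suc i))
               ≡ ℕtoℚ (gapTerm k n t i)
  term i = begin
    a *ℚ b *ℚ c *ℚ d       ≡⟨ *ℚ-assoc (a *ℚ b) c d ⟩
    (a *ℚ b) *ℚ (c *ℚ d)   ≡⟨ *-interchange a b c d ⟩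
    (a *ℚ c) *ℚ (b *ℚ d)   ≡⟨ cong₂ _*ℚ_ (Cb≡paths k (suc i) t) (sym (pathsBelow≡fraction k (n ∸ suc i))) ⟩
    ℕtoℚ (paths k (suc i) t) *ℚ ℕtoℚ (pathsBelow k (n ∸ suc i))
                           ≡⟨ ℕtoℚ-* (paths k (suc i) t) _ ⟨
    ℕtoℚ (gapTerm k n t i) ∎
    where
    a b c d : ℚ
    a = (+ (t + 1)) / suc ((k + 1) * suc i + t)
    b = (+ k) / suc (n ∸ suc i)
    c = ℕtoℚ (((k + 1) * suc i + t + 1) C (suc i))
    d = ℕtoℚ (((k + 1) * (n ∸ suc i)) C (n ∸ suc i))

-- Corollary 3.9.  All three expressions equal the embedded natural number
-- gapTotal k t n r: the first by the path-sum recursion, the other two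
-- term by term through the ballot numbers.
corollary3p9 : (k n r t : ℕ) → 1 ≤ k → 1 ≤ n → r < n → t ≤ k →
    (ℕtoℚ (s k n t r)
    ≡ sumℚ (map (λ j → Cb k n j) (upTo t))
    +ℚ sumℚ (map (λ i → Cb k (suc i) t *ℚ ℕtoℚ (s k (n ∸ suc i + 1) 0 1)) (upTo r)))
    × (sumℚ (map (λ j → Cb k n j) (upTo t))
    +ℚ sumℚ (map (λ i → Cb k (suc i) t *ℚ ℕtoℚ (s k (n ∸ suc i + 1) 0 1)) (upTo r))
    ≡ sumℚ (map (λ j → ((+ (j + 1)) / suc ((k + 1) * n + j))
    *ℚ ℕtoℚ (((k + 1) * n + j + 1) C n)) (upTo t))
    +ℚ sumℚ (map (λ i → ((+ (t + 1)) / suc ((k + 1) * suc i + t))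
    *ℚ ((+ k) / suc (n ∸ suc i))
    *ℚ ℕtoℚ (((k + 1) * suc i + t + 1) C (suc i))
    *ℚ ℕtoℚ (((k + 1) * (n ∸ suc i)) C (n ∸ suc i))) (upTo r)))
corollary3p9 k n r t _ _ r<n t≤k =
  trans viaPaths (sym viaRecursion) ,
  cong (ballotSum +ℚ_) (trans (recursiveGapSum k n r t r<n) (sym (closedGapSum k n r t)))
  where
  ballotSum recursiveSum : ℚ
  ballotSum    = sumℚ (map (λ j → Cb k n j) (upTo t))
  recursiveSum = sumℚ (map (λ i → Cb k (suc i) t *ℚ ℕtoℚ (s k (n ∸ suc i + 1) 0 1)) (upTo r))
  viaPaths : ℕtoℚ (s k n t r) ≡ ℕtoℚ (gapTotal k t n r)
  viaPaths = cong ℕtoℚ (s-gapTotal k n t r t≤k r<n)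
  viaRecursion : ballotSum +ℚ recursiveSum ≡ ℕtoℚ (gapTotal k t n r)
  viaRecursion = trans (cong₂ _+ℚ_ (sumℚ-upTo (Cb k n) (paths k n) t (λ j _ → Cb≡paths k n j))
                                  (recursiveGapSum k n r t r<n))
                       (sym (ℕtoℚ-+ (sumTo (paths k n) t) _))
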